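{- Let $k\geq 2$ and let $G$ be a graph with $\delta(G)\geq k-1$. If $d_{\times k}^{*}(G)\geq 3$, then $\gamma_{\times k}^{r}(G)=\gamma_{\times k}(G)$.
   Context: All graphs are finite, simple and undirected. For $G=(V,E)$ and $x\in V$, $N[x]$ is the closed neighborhood. For $\delta(G)\geq k-1$: $S\subseteq V$ is a $k$-tuple dominating set if $|N[x]\cap S|\geq k$ for all $x\in V$, and $\gamma_{\times k}(G)$ is the minimum cardinality of such a set; $S$ is a $k$-tuple restrained dominating set if moreover every vertex of $V-S$ has at least $k$ neighbors in $V-S$, and $\gamma_{\times k}^{r}(G)$ is the minimum cardinality of such a set. The star $k$-tuple domatic number $d_{\times k}^{*}(G)$ is the maximum number of classes of a partition of $V$ into $k$-tuple dominating sets of $G$ such that at least one class has cardinality $\gamma_{\times k}(G)$. -}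

module Defs where

open import Data.Nat using (ℕ; _≤_; _≥_; suc; _∸_)
open import Data.Fin using (Fin; _≟_)
open import Relation.Nullary.Decidable using (⌊_⌋)
open import Data.Bool using (Bool; true; false; _∧_; _∨_; not)
open import Data.Fin.Subset using (Subset; ∣_∣; _∈_; _∉_; ⁅_⁆; ∁)
open import Data.Vec using (tabulate; lookup)
open import Data.Product using (Σ; _×_; ∃)
open import Relation.Binary.PropositionalEquality using (_≡_)
open import Relation.Nullary using (¬_)

record Graph : Set where
  field
    n      : ℕ
    adj    : Fin n → Fin n → Bool
    irrefl : ∀ x → adj x x ≡ false
    sym    : ∀ x y → adj x y ≡ adj y x

module _ (G : Graph) where
  open Graph G

  V : Set
  V = Fin n

  N : V → Subset n
  N x = tabulate (λ y → adj x y)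

  N[_] : V → Subset n
  N[ x ] = tabulate (λ y → adj x y ∨ lookup ⁅ x ⁆ y)

  deg : V → ℕ
  deg x = ∣ N x ∣

  minDeg≥ : ℕ → Set
  minDeg≥ m = ∀ x → m ≤ deg x

  _∩_ : Subset n → Subset n → Subset n
  A ∩ B = tabulate (λ y → lookup A y ∧ lookup B y)

  IsKTupleDom : ℕ → Subset n → Set
  IsKTupleDom k S = ∀ x → k ≤ ∣ N[ x ] ∩ S ∣

  IsKTupleRDom : ℕ → Subset n → Set
  IsKTupleRDom k S = IsKTupleDom k S × (∀ x → x ∉ S → k ≤ ∣ N x ∩ ∁ S ∣)

  IsMinCard : (Subset n → Set) → ℕ → Set
  IsMinCard P m = (Σ (Subset n) λ S → P S × ∣ S ∣ ≡ m) × (∀ S → P S → m ≤ ∣ S ∣)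

  IsKTupleDomNumber : ℕ → ℕ → Set
  IsKTupleDomNumber k m = IsMinCard (IsKTupleDom k) m

  IsKTupleRDomNumber : ℕ → ℕ → Set
  IsKTupleRDomNumber k m = IsMinCard (IsKTupleRDom k) m

  -- the class i of a partition of V given by a class assignment f : V → Fin d
  classOf : {d : ℕ} → (V → Fin d) → Fin d → Subset n
  classOf f i = tabulate (λ x → ⌊ f x ≟ i ⌋)

  -- a partition of V into d k-tuple dominating sets with at least one class
  -- of cardinality γ_{×k}(G) (every class is nonempty, since it is k-tuple
  -- dominating with k ≥ 1 on a nonempty vertex set)
  IsStarKTupleDomPartition : ℕ → (d : ℕ) → (V → Fin d) → Set
  IsStarKTupleDomPartition k d f =
    (∀ i → IsKTupleDom k (classOf f i)) ×
    (∃ λ i → IsKTupleDomNumber k ∣ classOf f i ∣)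

  StarKTupleDomatic≥ : ℕ → ℕ → Set
  StarKTupleDomatic≥ k m =
    Σ ℕ λ d → m ≤ d × Σ (V → Fin d) λ f → IsStarKTupleDomPartition k d f

-- Let V₁, …, V_d (d ≥ 3) be a partition of V into k-tuple dominating sets with
-- |V_i| = γ_{×k}(G). A vertex x ∉ V_i lies in some class V_j, and a third class
-- V_l (l ≠ i, j) gives x at least k closed neighbours in V_l; none of them is x
-- itself or lies in V_i, so x has k neighbours outside V_i. Hence V_i is
-- k-tuple restrained dominating, and γ^r_{×k}(G) ≤ |V_i| = γ_{×k}(G) ≤ γ^r_{×k}(G).
module Submission where

open import Defs
open import Data.Nat using (ℕ; _≤_; _∸_; s≤s)
open import Data.Nat.Properties using (≤-antisym; ≤-trans)
open import Data.Bool using (Bool; T)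
open import Data.Bool.Properties using (T-≡; T-∧; T-∨)
open import Data.Fin using (Fin; zero; suc; _≟_)
open import Data.Fin.Subset using (Subset; ∣_∣; ∁; _∈_; _∉_; _⊆_)
open import Data.Fin.Subset.Properties using (p⊆q⇒∣p∣≤∣q∣; x∈⁅y⁆⇒x≡y; x∉p⇒x∈∁p)
open import Data.Vec using (lookup; tabulate)
open import Data.Vec.Properties using (lookup∘tabulate; []=⇒lookup; lookup⇒[]=)
open import Data.Product using (Σ; _×_; _,_; proj₁)
open import Data.Sum using (_⊎_; inj₁; inj₂)
open import Data.Empty using (⊥-elim)
open import Function.Bundles using (Equivalence)
open import Relation.Nullary using (yes; no)
open import Relation.Nullary.Decidable using (toWitness)
open import Relation.Binary.PropositionalEquality using (_≡_; _≢_; refl; sym; trans; subst)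

open Equivalence using (to; from)

module _ {n : ℕ} where

  ∈⇒T-lookup : {p : Subset n} {x : Fin n} → x ∈ p → T (lookup p x)
  ∈⇒T-lookup x∈p = from T-≡ ([]=⇒lookup x∈p)

  T-lookup⇒∈ : {p : Subset n} {x : Fin n} → T (lookup p x) → x ∈ p
  T-lookup⇒∈ {p} {x} t = lookup⇒[]= x p (to T-≡ t)

  ∈-tabulate⁻ : {f : Fin n → Bool} {x : Fin n} → x ∈ tabulate f → T (f x)
  ∈-tabulate⁻ {f} {x} x∈ = subst T (lookup∘tabulate f x) (∈⇒T-lookup x∈)

  ∈-tabulate⁺ : {f : Fin n → Bool} {x : Fin n} → T (f x) → x ∈ tabulate f
  ∈-tabulate⁺ {f} {x} t = T-lookup⇒∈ (subst T (sym (lookup∘tabulate f x)) t)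

third-index : ∀ {d} → 3 ≤ d → (a b : Fin d) → Σ (Fin d) λ l → a ≢ l × l ≢ b
third-index (s≤s (s≤s (s≤s _))) a b with a ≟ zero | b ≟ zero
... | no a≢0 | no b≢0 = zero , a≢0 , (λ 0≡b → b≢0 (sym 0≡b))
... | yes refl | _ with b ≟ suc zero
...   | no b≢1 = suc zero , (λ ()) , (λ 1≡b → b≢1 (sym 1≡b))
...   | yes refl = suc (suc zero) , (λ ()) , (λ ())
third-index (s≤s (s≤s (s≤s _))) a b | no a≢0 | yes refl with a ≟ suc zero
...   | no a≢1 = suc zero , a≢1 , (λ ())
...   | yes refl = suc (suc zero) , (λ ()) , (λ ())

module _ (G : Graph) where
  open Graph G using (n)

  ∈-∩⁻ : {A B : Subset n} {y : V G} → y ∈ _∩_ G A B → y ∈ A × y ∈ B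
  ∈-∩⁻ y∈A∩B with to T-∧ (∈-tabulate⁻ y∈A∩B)
  ... | tA , tB = T-lookup⇒∈ tA , T-lookup⇒∈ tB

  ∈-∩⁺ : {A B : Subset n} {y : V G} → y ∈ A → y ∈ B → y ∈ _∩_ G A B
  ∈-∩⁺ y∈A y∈B = ∈-tabulate⁺ (from T-∧ (∈⇒T-lookup y∈A , ∈⇒T-lookup y∈B))

  ∈N[]⁻ : {x y : V G} → y ∈ N[_] G x → y ∈ N G x ⊎ y ≡ x
  ∈N[]⁻ {x} y∈N[x] with to T-∨ (∈-tabulate⁻ y∈N[x])
  ... | inj₁ adj = inj₁ (∈-tabulate⁺ adj)
  ... | inj₂ y∈⁅x⁆ = inj₂ (x∈⁅y⁆⇒x≡y x (T-lookup⇒∈ y∈⁅x⁆))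

  module _ {d : ℕ} (f : V G → Fin d) where

    ∈-classOf⁻ : {i : Fin d} {y : V G} → y ∈ classOf G f i → f y ≡ i
    ∈-classOf⁻ y∈Vi = toWitness (∈-tabulate⁻ y∈Vi)

    N[]∩classOf⊆N∩∁classOf : {i l : Fin d} {x : V G} → f x ≢ l → l ≢ i →
      _∩_ G (N[_] G x) (classOf G f l) ⊆ _∩_ G (N G x) (∁ (classOf G f i))
    N[]∩classOf⊆N∩∁classOf fx≢l l≢i y∈ with ∈-∩⁻ y∈
    ... | y∈N[x] , y∈Vl with ∈-classOf⁻ y∈Vl | ∈N[]⁻ y∈N[x]
    ...   | fy≡l | inj₂ refl = ⊥-elim (fx≢l fy≡l)
    ...   | fy≡l | inj₁ y∈Nx =
      ∈-∩⁺ y∈Nx (x∉p⇒x∈∁p λ y∈Vi → l≢i (trans (sym fy≡l) (∈-classOf⁻ y∈Vi)))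

    classOf-isKTupleRDom : {k : ℕ} → 3 ≤ d → (∀ j → IsKTupleDom G k (classOf G f j)) →
      ∀ i → IsKTupleRDom G k (classOf G f i)
    classOf-isKTupleRDom {k} 3≤d dom i = dom i , restrained
      where
      restrained : ∀ x → x ∉ classOf G f i → k ≤ ∣ _∩_ G (N G x) (∁ (classOf G f i)) ∣
      restrained x _ with third-index 3≤d (f x) i
      ... | l , fx≢l , l≢i =
        ≤-trans (dom l x) (p⊆q⇒∣p∣≤∣q∣ (N[]∩classOf⊆N∩∁classOf fx≢l l≢i))

  isMinCard-unique : {P : Subset n → Set} {m m′ : ℕ} →
    IsMinCard G P m → IsMinCard G P m′ → m ≡ m′
  isMinCard-unique ((S , PS , ∣S∣≡m) , m≤) ((S′ , PS′ , ∣S′∣≡m′) , m′≤) =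
    ≤-antisym (subst (_ ≤_) ∣S′∣≡m′ (m≤ S′ PS′)) (subst (_ ≤_) ∣S∣≡m (m′≤ S PS))

  isMinCard-mono : {P Q : Subset n → Set} {m : ℕ} {S : Subset n} → (∀ T → Q T → P T) →
    IsMinCard G P m → Q S → ∣ S ∣ ≡ m → IsMinCard G Q m
  isMinCard-mono Q⇒P (_ , m≤) QS ∣S∣≡m = (_ , QS , ∣S∣≡m) , λ T QT → m≤ T (Q⇒P T QT)

theorem4p7 : (k : ℕ) → 2 ≤ k → (G : Graph) → minDeg≥ G (k ∸ 1) →
    StarKTupleDomatic≥ G k 3 →
    (m : ℕ) → IsKTupleDomNumber G k m → IsKTupleRDomNumber G k m
theorem4p7 k _ G _ (d , 3≤d , f , classesDom , i , γ≡∣Vi∣) m γ≡m =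
  isMinCard-mono G (λ _ → proj₁) γ≡m
    (classOf-isKTupleRDom G f 3≤d classesDom i)
    (isMinCard-unique G {P = IsKTupleDom G k} γ≡∣Vi∣ γ≡m)
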